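{- Let $t,p$ be positive integers and let $\lambda$ be a $(t,t+1,\ldots,t+p)$-core partition. Then \[ \beta(\lambda)\subseteq\bigcup_{1\leq k\leq \lfloor\frac{t+p-2}{p}\rfloor}S_k,\qquad\text{where } S_k=\{x\in\mathbb{Z}:(k-1)(t+p)+1\leq x\leq kt-1\}. \]
   Context: A partition $\lambda=(\lambda_1,\ldots,\lambda_r)$ is a finite weakly decreasing sequence of positive integers. In its Young diagram, the hook length $h(i,j)$ of box $(i,j)$ is the number of boxes directly to its right, directly below it, plus the box itself. $\lambda$ is a $t$-core partition if no hook length is divisible by $t$, and a $(t_1,\ldots,t_m)$-core partition if it is a $t_i$-core for all $i$. The $\beta$-set of $\lambda$ is $\beta(\lambda)=\{h(i,1):1\leq i\leq r\}$ (empty for the empty partition). $\lfloor x\rfloor$ denotes the floor of $x$; an empty union is the empty set. -}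

module Defs where

open import Data.Nat using (ℕ; zero; suc; _+_; _*_; _∸_; _≤_; _<_; _≥_; _≤?_)
open import Data.Nat.Divisibility using (_∣_)
open import Data.List using (List; []; _∷_; length; filter)
open import Data.List.Relation.Unary.All using (All)
open import Data.List.Relation.Unary.Linked using (Linked)
open import Data.Product using (Σ; _×_; ∃-syntax)
open import Relation.Nullary using (¬_)
open import Relation.Binary.PropositionalEquality using (_≡_)

record IsPartition (λs : List ℕ) : Set where
  field
    positive   : All (λ a → 1 ≤ a) λs
    decreasing : Linked _≥_ λs

rows : List ℕ → ℕ
rows = length

-- The i-th part, 1-indexed (0 outside the range).
part : List ℕ → ℕ → ℕ
part []       _             = 0
part (a ∷ as) zero          = 0
part (a ∷ as) (suc zero)    = a
part (a ∷ as) (suc (suc i)) = part as (suc i)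

conj : List ℕ → ℕ → ℕ
conj λs j = length (filter (j ≤?_) λs)

InDiagram : List ℕ → ℕ → ℕ → Set
InDiagram λs i j = 1 ≤ i × i ≤ rows λs × 1 ≤ j × j ≤ part λs i

hook : List ℕ → ℕ → ℕ → ℕ
hook λs i j = (part λs i ∸ j) + (conj λs j ∸ i) + 1

IsCore : ℕ → List ℕ → Set
IsCore t λs = ∀ i j → InDiagram λs i j → ¬ (t ∣ hook λs i j)

IsCoreRange : ℕ → ℕ → List ℕ → Set
IsCoreRange t p λs = ∀ m → m ≤ p → IsCore (t + m) λs

_∈β_ : ℕ → List ℕ → Set
x ∈β λs = ∃[ i ] (1 ≤ i × i ≤ rows λs × x ≡ hook λs i 1)

-- x ∈ S_k = { x : (k-1)(t+p)+1 ≤ x ≤ kt-1 }   (x ≤ kt-1 written as x < kt).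
InS : ℕ → ℕ → ℕ → ℕ → Set
InS t p k x = (k ∸ 1) * (t + p) + 1 ≤ x × x < k * t

-- The first-column hook lengths of a (t, t+1, …, t+p)-core avoid every
-- "window" [m·t, m·(t+p)], and what is left of ℕ⁺ is exactly ⋃ₖ Sₖ.
--
-- The β-set of λ = (a ∷ rest) is { a + |rest| } ∪ β(rest), i.e. the numbers
-- λᵢ + (r − i).  The abacus fact behind the proof is that the β-set of an
-- s-core is closed under x ↦ x − s (for s ≤ x): every number below the top
-- β-number a + |rest| is either a β-number of rest or equals a + |rest| minus
-- a hook length of the first row.  Since λ is a (t+d)-core for every d ≤ p,
-- and every x in the window [(m+1)t, (m+1)(t+p)] can step down by some t + d
-- into the window [m·t, m·(t+p)], induction on m pushes a β-number lying in a
-- window down to 0, which is not a β-number.  Finally, writing x − 1 =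
-- r + q(t+p) with r < t+p, a positive x outside the window of index q+1 lies
-- in S_{q+1}, and being below (q+1)t forces q+1 ≤ ⌊(t+p−2)/p⌋.
module Submission where

open import Defs
open import Data.Nat using (ℕ; _+_; _∸_; _≤_; _/_; >-nonZero)
open import Data.List using (List)
open import Data.Product using (_×_; ∃-syntax)

open import Data.Nat using (zero; suc; _*_; _<_; _≥_; _≤?_; z≤n; s≤s; _%_)
open import Data.Nat.Properties
open import Data.Nat.DivMod using (m≡m%n+[m/n]*n; m%n<n; /-monoˡ-≤; m*n/n≡m)
open import Data.Nat.Divisibility using (_∣_; ∣-refl)
open import Data.Nat.Tactic.RingSolver using (solve-∀)
open import Data.List using ([]; _∷_; length)
open import Data.List.Properties using (filter-accept; filter-reject)
open import Data.List.Relation.Unary.All as All using (All; []; _∷_)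
open import Data.List.Relation.Unary.Linked as Linked using (Linked)
open import Data.List.Relation.Unary.Linked.Properties using (Linked⇒All)
open import Data.Product using (_,_)
open import Data.Sum using (_⊎_; inj₁; inj₂)
open import Data.Empty using (⊥; ⊥-elim)
open import Relation.Nullary using (¬_; yes; no)
open import Relation.Binary using (tri<; tri≈; tri>)
open import Relation.Binary.PropositionalEquality
  using (_≡_; refl; sym; trans; cong; subst; subst₂; module ≡-Reasoning)

conj-accept : ∀ a rest j → j ≤ a → conj (a ∷ rest) j ≡ suc (conj rest j)
conj-accept a rest j j≤a = cong length (filter-accept (j ≤?_) j≤a)

conj-reject : ∀ a rest j → a < j → conj (a ∷ rest) j ≡ conj rest j
conj-reject a rest j a<j = cong length (filter-reject (j ≤?_) (<⇒≱ a<j))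

conj-empty : ∀ l j → All (_< j) l → conj l j ≡ 0
conj-empty []      j []         = refl
conj-empty (a ∷ l) j (a<j ∷ l<j) = trans (conj-reject a l j a<j) (conj-empty l j l<j)

conj-first : ∀ l → All (1 ≤_) l → conj l 1 ≡ length l
conj-first []      []          = refl
conj-first (a ∷ l) (1≤a ∷ pos) = trans (conj-accept a l 1 1≤a) (cong suc (conj-first l pos))

head-bounds : ∀ {a rest} → Linked _≥_ (a ∷ rest) → All (_≤ a) rest
head-bounds L = All.tail (Linked⇒All (λ y≤x z≤y → ≤-trans z≤y y≤x) ≤-refl L)

part-bound : ∀ a l i → All (_≤ a) l → part l i ≤ a
part-bound a []      i             _           = z≤n
part-bound a (b ∷ l) zero          _           = z≤n
part-bound a (b ∷ l) (suc zero)    (b≤a ∷ _)   = b≤a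
part-bound a (b ∷ l) (suc (suc i)) (_ ∷ l≤a)   = part-bound a l (suc i) l≤a

hook-tail : ∀ a rest i j → j ≤ a → hook (a ∷ rest) (suc (suc i)) j ≡ hook rest (suc i) j
hook-tail a rest i j j≤a rewrite conj-accept a rest j j≤a = refl

first-row-hook : ∀ a rest j → j ≤ a → hook (a ∷ rest) 1 j ≡ (a ∸ j) + conj rest j + 1
first-row-hook a rest j j≤a rewrite conj-accept a rest j j≤a = refl

partition-tail : ∀ {a rest} → IsPartition (a ∷ rest) → IsPartition rest
partition-tail P = record
  { positive   = All.tail (IsPartition.positive P)
  ; decreasing = Linked.tail (IsPartition.decreasing P) }

core-tail : ∀ {s a rest} → IsPartition (a ∷ rest) → IsCore s (a ∷ rest) → IsCore s rest
core-tail P C zero    j (() , _)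
core-tail {s} {a} {rest} P C (suc i) j (_ , i≤r , 1≤j , j≤part) s∣hook =
  C (suc (suc i)) j (s≤s z≤n , s≤s i≤r , 1≤j , j≤part) (subst (s ∣_) (sym below) s∣hook)
  where
  below : hook (a ∷ rest) (suc (suc i)) j ≡ hook rest (suc i) j
  below = hook-tail a rest i j
    (≤-trans j≤part (part-bound a rest (suc i) (head-bounds (IsPartition.decreasing P))))

FirstColumn : List ℕ → ℕ → Set
FirstColumn []         x = ⊥
FirstColumn (a ∷ rest) x = x ≡ a + length rest ⊎ FirstColumn rest x

firstColumn-positive : ∀ l x → All (1 ≤_) l → FirstColumn l x → 1 ≤ x
firstColumn-positive (a ∷ l) x (1≤a ∷ _) (inj₁ refl) = ≤-trans 1≤a (m≤m+n a (length l))
firstColumn-positive (a ∷ l) x (_ ∷ pos) (inj₂ x∈l) = firstColumn-positive l x pos x∈l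

β⇒firstColumn : ∀ l → IsPartition l → ∀ x → x ∈β l → FirstColumn l x
β⇒firstColumn [] P x (i , 1≤i , i≤0 , _) = ⊥-elim (<⇒≱ 1≤i i≤0)
β⇒firstColumn (a ∷ l) P x (zero , () , _)
β⇒firstColumn (zero ∷ l) P x (suc zero , _) = ⊥-elim (n≮n 0 (All.head (IsPartition.positive P)))
β⇒firstColumn (suc a ∷ l) P x (suc zero , _ , _ , refl)
  rewrite conj-first l (All.tail (IsPartition.positive P)) = inj₁ (+-comm (a + length l) 1)
β⇒firstColumn (a ∷ l) P x (suc (suc i) , _ , s≤s i≤r , x≡hook) =
  inj₂ (β⇒firstColumn l (partition-tail P) x (suc i , s≤s z≤n , i≤r , trans x≡hook below))
  where
  below : hook (a ∷ l) (suc (suc i)) 1 ≡ hook l (suc i) 1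
  below = hook-tail a l i 1 (All.head (IsPartition.positive P))

-- Every y below a + |rest| is a β-number of rest or the "gap" of a column
-- j ≤ a, meaning that a + |rest| − y is the hook of box (1, j) (see below).
gap-or-firstColumn : ∀ rest → Linked _≥_ rest → ∀ a → All (_≤ a) rest →
  ∀ y → y < a + length rest →
  FirstColumn rest y ⊎ ∃[ j ] (1 ≤ j × j ≤ a × j + length rest ≡ y + 1 + conj rest j)
gap-or-firstColumn [] L a [] y y<a =
  inj₂ (suc y , s≤s z≤n , subst (suc y ≤_) (+-identityʳ a) y<a , cong (_+ 0) (+-comm 1 y))
gap-or-firstColumn (b ∷ rest) L a (b≤a ∷ _) y y<top with <-cmp y (b + length rest)
... | tri≈ _ y≡b+n _ = inj₁ (inj₁ y≡b+n)
... | tri< y<b+n _ _ with gap-or-firstColumn rest (Linked.tail L) b (head-bounds L) y y<b+n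
...   | inj₁ y∈rest = inj₁ (inj₂ y∈rest)
...   | inj₂ (j , 1≤j , j≤b , gap) = inj₂ (j , 1≤j , ≤-trans j≤b b≤a , gap′)
  where
  open ≡-Reasoning
  n = length rest
  c = conj rest j
  gap′ : j + suc n ≡ y + 1 + conj (b ∷ rest) j
  gap′ = begin
    j + suc n         ≡⟨ +-suc j n ⟩
    suc (j + n)       ≡⟨ cong suc gap ⟩
    suc (y + 1 + c)   ≡⟨ sym (+-suc (y + 1) c) ⟩
    y + 1 + suc c     ≡⟨ cong (y + 1 +_) (sym (conj-accept b rest j j≤b)) ⟩
    y + 1 + conj (b ∷ rest) j ∎
gap-or-firstColumn (b ∷ rest) L a (b≤a ∷ _) y y<top | tri> _ _ b+n<y
  with m≤n⇒∃[o]m+o≡n (≤-trans (m≤n+m (length rest) b) (<⇒≤ b+n<y))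
... | j , refl = inj₂ (j , ≤-trans (s≤s z≤n) b<j , j≤a , gap)
  where
  n = length rest
  b<j : b < j
  b<j = +-cancelˡ-≤ n (suc b) j (subst (_≤ n + j) (trans (cong suc (+-comm b n)) (sym (+-suc n b))) b+n<y)
  j≤a : j ≤ a
  j≤a = +-cancelˡ-≤ n j a (subst (n + j ≤_) (+-comm a n) (≤-pred (subst (suc (n + j) ≤_) (+-suc a n) y<top)))
  column-empty : conj (b ∷ rest) j ≡ 0
  column-empty = conj-empty (b ∷ rest) j
    (b<j ∷ All.map (λ c≤b → <-≤-trans (s≤s c≤b) b<j) (head-bounds L))
  gap : j + suc n ≡ n + j + 1 + conj (b ∷ rest) j
  gap rewrite column-empty = shift j n
    where
    shift : ∀ j n → j + suc n ≡ n + j + 1 + 0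
    shift = solve-∀

top-step : ∀ {s a rest} → IsPartition (a ∷ rest) → IsCore s (a ∷ rest) →
  1 ≤ s → s ≤ a + length rest → FirstColumn rest (a + length rest ∸ s)
top-step {s} {a} {rest} P C 1≤s s≤top
  with gap-or-firstColumn rest (Linked.tail (IsPartition.decreasing P)) a
         (head-bounds (IsPartition.decreasing P)) (a + length rest ∸ s) (∸-monoʳ-< 1≤s s≤top)
... | inj₁ y∈rest = y∈rest
... | inj₂ (j , 1≤j , j≤a , gap) =
  ⊥-elim (C 1 j (s≤s z≤n , s≤s z≤n , 1≤j , j≤a) (subst (s ∣_) (sym hook≡s) ∣-refl))
  where
  open ≡-Reasoning
  n = length rest
  y = a + n ∸ s
  c = conj rest j
  shifted : y + s ≡ y + ((a ∸ j) + c + 1)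
  shifted = begin
    y + s                   ≡⟨ +-comm y s ⟩
    s + y                   ≡⟨ m+[n∸m]≡n s≤top ⟩
    a + n                   ≡⟨ cong (_+ n) (sym (m∸n+n≡m j≤a)) ⟩
    (a ∸ j) + j + n         ≡⟨ +-assoc (a ∸ j) j n ⟩
    (a ∸ j) + (j + n)       ≡⟨ cong ((a ∸ j) +_) gap ⟩
    (a ∸ j) + (y + 1 + c)   ≡⟨ rearrange (a ∸ j) y c ⟩
    y + ((a ∸ j) + c + 1)   ∎
    where
    rearrange : ∀ A y c → A + (y + 1 + c) ≡ y + (A + c + 1)
    rearrange = solve-∀
  hook≡s : hook (a ∷ rest) 1 j ≡ s
  hook≡s = trans (first-row-hook a rest j j≤a) (sym (+-cancelˡ-≡ y _ _ shifted))

firstColumn-closed : ∀ {s} l → IsPartition l → IsCore s l → 1 ≤ s →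
  ∀ x → FirstColumn l x → s ≤ x → FirstColumn l (x ∸ s)
firstColumn-closed (a ∷ rest) P C 1≤s x (inj₁ refl) s≤x = inj₂ (top-step P C 1≤s s≤x)
firstColumn-closed (a ∷ rest) P C 1≤s x (inj₂ x∈rest) s≤x =
  inj₂ (firstColumn-closed rest (partition-tail P) (core-tail P C) 1≤s x x∈rest s≤x)

interval-split : ∀ a α b β x → a + b ≤ x → x ≤ (a + α) + (b + β) →
  ∃[ d ] (d ≤ α × a + d ≤ x × b ≤ x ∸ (a + d) × x ∸ (a + d) ≤ b + β)
interval-split a α b β x lo hi with m≤n⇒∃[o]m+o≡n lo
... | u , refl with u ≤? β
...   | yes u≤β = 0 , z≤n , a≤x , subst (b ≤_) (sym remainder) (m≤m+n b u) ,
                  subst (_≤ b + β) (sym remainder) (+-monoʳ-≤ b u≤β)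
  where
  a≤x : a + 0 ≤ a + b + u
  a≤x = subst (_≤ a + b + u) (sym (+-identityʳ a)) (≤-trans (m≤m+n a b) (m≤m+n (a + b) u))
  remainder : a + b + u ∸ (a + 0) ≡ b + u
  remainder rewrite +-identityʳ a | +-assoc a b u = m+n∸m≡n a (b + u)
...   | no u≰β with m≤n⇒∃[o]m+o≡n (<⇒≤ (≰⇒> u≰β))
...     | e , refl = e , e≤α , subst (a + e ≤_) (sym regroup) (m≤m+n (a + e) (b + β)) ,
                     subst (b ≤_) (sym remainder) (m≤m+n b β) ,
                     ≤-reflexive remainder
  where
  regroup : a + b + (β + e) ≡ a + e + (b + β)
  regroup = swap a b β e
    where
    swap : ∀ a b β e → a + b + (β + e) ≡ a + e + (b + β)
    swap = solve-∀
  remainder : a + b + (β + e) ∸ (a + e) ≡ b + β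
  remainder = trans (cong (_∸ (a + e)) regroup) (m+n∸m≡n (a + e) (b + β))
  e≤α : e ≤ α
  e≤α = +-cancelˡ-≤ (a + b + β) e α (subst₂ _≤_ (reassoc a b β e) (reassoc′ a α b β) hi)
    where
    reassoc : ∀ a b β e → a + b + (β + e) ≡ (a + b + β) + e
    reassoc = solve-∀
    reassoc′ : ∀ a α b β → (a + α) + (b + β) ≡ (a + b + β) + α
    reassoc′ = solve-∀

-- The window of index m: the sums of m numbers from [t, t+p].
Window : ℕ → ℕ → ℕ → ℕ → Set
Window t p m x = m * t ≤ x × x ≤ m * (t + p)

window-step : ∀ t p m x → Window t p (suc m) x →
  ∃[ d ] (d ≤ p × t + d ≤ x × Window t p m (x ∸ (t + d)))
window-step t p m x (lo , hi)
  with interval-split t p (m * t) (m * p) x lo (subst (x ≤_) (cong (t + p +_) (*-distribˡ-+ m t p)) hi)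
... | d , d≤p , t+d≤x , lo′ , hi′ =
  d , d≤p , t+d≤x , lo′ , subst (x ∸ (t + d) ≤_) (sym (*-distribˡ-+ m t p)) hi′

firstColumn-avoids-windows : ∀ t p → 1 ≤ t → ∀ l → IsPartition l → IsCoreRange t p l →
  ∀ m x → FirstColumn l x → ¬ Window t p m x
firstColumn-avoids-windows t p 1≤t l P C zero x x∈l (_ , x≤0) =
  <⇒≱ (firstColumn-positive l x (IsPartition.positive P) x∈l) (subst (x ≤_) (*-zeroˡ (t + p)) x≤0)
firstColumn-avoids-windows t p 1≤t l P C (suc m) x x∈l inWindow
  with window-step t p m x inWindow
... | d , d≤p , t+d≤x , lower =
  firstColumn-avoids-windows t p 1≤t l P C m (x ∸ (t + d))
    (firstColumn-closed l P (C d d≤p) (≤-trans 1≤t (m≤m+n t d)) x x∈l t+d≤x) lower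

index-bound : ∀ t p (hp : 1 ≤ p) q → q * (t + p) + 2 ≤ suc q * t →
  suc q ≤ _/_ (t + p ∸ 2) p {{>-nonZero hp}}
index-bound t p hp q gap =
  subst (_≤ (t + p ∸ 2) / p) (m*n/n≡m (suc q) p) (/-monoˡ-≤ p (m+n≤o⇒m≤o∸n (p + q * p) stretched))
  where
  instance nonZero = >-nonZero hp
  expand : ∀ q t p → q * (t + p) + 2 ≡ q * t + (q * p + 2)
  expand = solve-∀
  room : q * p + 2 ≤ t
  room = +-cancelˡ-≤ (q * t) _ _ (subst₂ _≤_ (expand q t p) (+-comm t (q * t)) gap)
  regroup : ∀ p Q → (Q + 2) + p ≡ p + Q + 2
  regroup = solve-∀
  stretched : p + q * p + 2 ≤ t + p
  stretched = subst (_≤ t + p) (regroup p (q * p)) (+-monoˡ-≤ p room)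

window-or-S : ∀ t p (hp : 1 ≤ p) x → 1 ≤ x →
  ∃[ m ] Window t p m x ⊎ ∃[ k ] (1 ≤ k × k ≤ _/_ (t + p ∸ 2) p {{>-nonZero hp}} × InS t p k x)
window-or-S t p hp (suc x) _ = classify (x % (t + p)) (x / (t + p)) (m%n<n x (t + p)) (m≡m%n+[m/n]*n x (t + p))
  where
  instance nonZero = >-nonZero (≤-trans hp (m≤n+m p t))
  classify : ∀ r q → r < t + p → x ≡ r + q * (t + p) →
    ∃[ m ] Window t p m (suc x) ⊎ ∃[ k ] (1 ≤ k × k ≤ _/_ (t + p ∸ 2) p {{>-nonZero hp}} × InS t p k (suc x))
  classify r q r<t+p refl with suc q * t ≤? suc x
  ... | yes inside = inj₁ (suc q , inside , +-monoˡ-≤ (q * (t + p)) r<t+p)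
  ... | no  below  = inj₂ (suc q , s≤s z≤n , index-bound t p hp q gap , start , ≰⇒> below)
    where
    start : q * (t + p) + 1 ≤ suc x
    start = subst (_≤ suc x) (+-comm 1 (q * (t + p))) (s≤s (m≤n+m (q * (t + p)) r))
    gap : q * (t + p) + 2 ≤ suc q * t
    gap = ≤-trans (subst (_≤ suc (suc x)) (+-comm 2 (q * (t + p))) (s≤s (s≤s (m≤n+m (q * (t + p)) r))))
                  (≰⇒> below)

lemma2p5 : (t p : ℕ) → 1 ≤ t → (hp : 1 ≤ p) → (λs : List ℕ) → IsPartition λs →
    IsCoreRange t p λs →
    ∀ x → x ∈β λs →
    ∃[ k ] (1 ≤ k × k ≤ _/_ (t + p ∸ 2) p {{>-nonZero hp}} × InS t p k x)
lemma2p5 t p 1≤t hp λs P C x x∈β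
  with window-or-S t p hp x (firstColumn-positive λs x (IsPartition.positive P) (β⇒firstColumn λs P x x∈β))
... | inj₂ inS          = inS
... | inj₁ (m , window) =
  ⊥-elim (firstColumn-avoids-windows t p 1≤t λs P C m x (β⇒firstColumn λs P x x∈β) window)
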